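{- For any index ${\bf k}=(k_{1}, \ldots , k_{r}) \in {\mathbb N}^{r}$ with $r \ge 2$ and primitive $n$-th root of unity $\zeta_n$, it holds that \begin{align*} \omega_{n}({\bf k}; \zeta_{n})=(-1)^{k_{r}} \sum_{j=1}^{k_{r}}\binom{k_{r}-1}{j-1}(1-q)^{k_{r}-j} z_{n}(a^{j}(e_{k_{1}} \mathbin{\sqcup\!\sqcup}_\hbar \cdots \mathbin{\sqcup\!\sqcup}_\hbar e_{k_{r-1}}))\big|_{q=\zeta_n}. \end{align*}
   Context: Let $[m]=(1-q^m)/(1-q)$, $F_k(m)=q^{(k-1)m}/[m]^k$ ($k\in\mathbb{N}$), $F_{\hat1}(m)=q^m/[m]$, and for ${\bf k}\in(\mathbb{N}\sqcup\{\hat1\})^r$, $L_{\bf k}(t)=\sum_{m_1>\cdots>m_r>0}t^{m_1}\prod_aF_{k_a}(m_a)$. Let $\mathcal{C}=\mathbb{Q}[\hbar,\hbar^{ -1}]$, $\mathfrak{H}=\mathcal{C}\langle a,b\rangle$, $e_{\hat1}=ab$, $e_k=a^{k-1}(a+\hbar)b$, $e_{\bf k}=e_{k_1}\cdots e_{k_r}$, $\widehat{\mathfrak{H}}^1$ the subalgebra freely generated by the $e_k$, and $\mathcal{L}:\widehat{\mathfrak{H}}^1\to\mathbb{C}[[t]]$ the $\mathcal{C}$-linear map $e_{\bf k}\mapsto L_{\bf k}(t)$ (with $\hbar$ acting as $1-q$). The product $\mathbin{\sqcup\!\sqcup}_\hbar$ on $\mathfrak{H}$ is $\mathcal{C}$-bilinear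 with $aw\mathbin{\sqcup\!\sqcup}_\hbar aw'=a(aw\mathbin{\sqcup\!\sqcup}_\hbar w'+w\mathbin{\sqcup\!\sqcup}_\hbar aw'+\hbar\,w\mathbin{\sqcup\!\sqcup}_\hbar w')$, $bw\mathbin{\sqcup\!\sqcup}_\hbar w'=w\mathbin{\sqcup\!\sqcup}_\hbar bw'=b(w\mathbin{\sqcup\!\sqcup}_\hbar w')$, unit $1$; it preserves $\widehat{\mathfrak{H}}^1$, and $\widehat{\mathfrak{H}}^1$ is stable under left multiplication by $a$. For $w\in\widehat{\mathfrak{H}}^1$ let $u_m(w)$ be the coefficient of $t^m$ in $\mathcal{L}(w)$ and $z_n(w)=\sum_{m=1}^{n-1}u_m(w)$ (with $\hbar$ acting as $1-q$). Finally $\omega_n({\bf k};q)=\sum_{m_1+\cdots+m_r=n,\,m_a>0}\prod_a q^{(k_a-1)m_a}/[m_a]^{k_a}$; these are evaluated at $q=\zeta_n$. -}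

module Defs where

open import Level using (Level; _⊔_) renaming (suc to lsuc)
open import Algebra.Bundles using (CommutativeRing)
open import Data.Nat using (ℕ; zero; suc; _∸_; _≤_; _<_)
  renaming (_+_ to _+ℕ_; _*_ to _*ℕ_)
open import Data.Nat.Combinatorics using (_C_)
open import Data.List using (List; []; _∷_; _++_; map; concatMap; replicate; foldr)
open import Data.Maybe using (Maybe; just; nothing)
  renaming (map to mapMaybe)
open import Data.Product using (_×_; _,_)
open import Relation.Nullary using (¬_)

record Field (c ℓ : Level) : Set (lsuc (c ⊔ ℓ)) where
  field
    commutativeRing : CommutativeRing c ℓ
  open CommutativeRing commutativeRing public
  field
    _⁻¹       : Carrier → Carrier
    ⁻¹-inverse : ∀ x → ¬ (x ≈ 0#) → (x * (x ⁻¹)) ≈ 1#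
    0≉1       : ¬ (0# ≈ 1#)

module FieldOps {c ℓ : Level} (K : Field c ℓ) where
  open Field K

  pow : Carrier → ℕ → Carrier
  pow x zero    = 1#
  pow x (suc k) = x * pow x k

  natK : ℕ → Carrier
  natK zero    = 0#
  natK (suc m) = 1# + natK m

  sumFrom : ℕ → ℕ → (ℕ → Carrier) → Carrier
  sumFrom lo zero      f = 0#
  sumFrom lo (suc len) f = f lo + sumFrom (suc lo) len f

  sumRange : ℕ → ℕ → (ℕ → Carrier) → Carrier
  sumRange lo hi f = sumFrom lo (suc hi ∸ lo) f

CharZero : ∀ {c ℓ} → Field c ℓ → Set ℓ
CharZero K = ∀ m → ¬ (natK (suc m) ≈ 0#)
  where open Field K ; open FieldOps K

PrimitiveRoot : ∀ {c ℓ} (K : Field c ℓ) → ℕ → Field.Carrier K → Set ℓ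
PrimitiveRoot K n ζ = (pow ζ n ≈ 1#) × (∀ m → 1 ≤ m → m < n → ¬ (pow ζ m ≈ 1#))
  where open Field K ; open FieldOps K

data Letter : Set where
  a b : Letter

Word : Set
Word = List Letter

module AtRoot {c ℓ : Level} (K : Field c ℓ) (ζ : Field.Carrier K) where
  open Field K
  open FieldOps K public

  q : Carrier
  q = ζ

  ħ : Carrier
  ħ = 1# - q

  qint : ℕ → Carrier
  qint m = sumFrom 0 m (pow q)

  Fk : ℕ → ℕ → Carrier
  Fk k m = pow q ((k ∸ 1) *ℕ m) * pow (qint m ⁻¹) k

  Fhat : ℕ → Carrier
  Fhat m = pow q m * (qint m ⁻¹)

  -- ω_n(k;q) = Σ_{m_1+...+m_r = n, m_a > 0} Π_a q^{(k_a-1)m_a}/[m_a]^{k_a}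
  omega : ℕ → List ℕ → Carrier
  omega zero    []       = 1#
  omega (suc n) []       = 0#
  omega n       (k ∷ ks) = sumRange 1 n (λ m → Fk k m * omega (n ∸ m) ks)

  -- The algebra 𝔥 (coefficients specialised along ħ ↦ 1 - ζ) as formal
  -- linear combinations of words in a, b.

  H : Set c
  H = List (Carrier × Word)

  scale : Carrier → H → H
  scale s = map (λ { (x , w) → (s * x , w) })

  prefix : Letter → H → H
  prefix l = map (λ { (x , w) → (x , l ∷ w) })

  one : H
  one = (1# , []) ∷ []

  shw : Word → Word → H
  shw []      w'       = (1# , w') ∷ []
  shw (b ∷ w) w'       = prefix b (shw w w')
  shw (a ∷ w) []       = (1# , a ∷ w) ∷ []
  shw (a ∷ w) (b ∷ w') = prefix b (shw (a ∷ w) w')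
  shw (a ∷ w) (a ∷ w') =
    prefix a (shw (a ∷ w) w' ++ shw w (a ∷ w') ++ scale ħ (shw w w'))

  sh : H → H → H
  sh x y = concatMap (λ { (s , w) → concatMap (λ { (t , w') → scale (s * t) (shw w w') }) y }) x

  as : ℕ → Word
  as k = replicate k a

  -- e_k = a^{k-1}(a + ħ) b   (k ≥ 1)
  e : ℕ → H
  e k = (1# , as k ++ (b ∷ [])) ∷ (ħ , as (k ∸ 1) ++ (b ∷ [])) ∷ []

  aPow : ℕ → H → H
  aPow zero    x = x
  aPow (suc j) x = prefix a (aPow j x)

  shuffleE : List ℕ → H
  shuffleE ks = foldr (λ k acc → sh (e k) acc) one ks

  -- The map 𝓛 on Ĥ^1 (= C ⊕ 𝔥 b since ħ is invertible).
  -- Value of 𝓛 at the single block a^k b at t^m, determined by the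
  -- relations  a b = e_{\hat1},  a^k b = e_k - ħ a^{k-1} b  (k ≥ 2),
  --            b = ħ^{-1} (e_1 - e_{\hat1}).
  G : ℕ → ℕ → Carrier
  G zero          m = (ħ ⁻¹) * (Fk 1 m - Fhat m)
  G (suc zero)    m = Fhat m
  G (suc (suc k)) m = Fk (suc (suc k)) m - ħ * G (suc k) m

  -- coefficient of t^m in 𝓛(a^{k_1} b ... a^{k_r} b)
  --   = Σ_{m = m_1 > ... > m_r > 0} Π_a G_{k_a}(m_a)   (by multilinearity)
  coeffBlocks : ℕ → List ℕ → Carrier
  coeffBlocks zero    []       = 1#
  coeffBlocks (suc m) []       = 0#
  coeffBlocks zero    (k ∷ ks) = 0#
  coeffBlocks (suc m) (k ∷ ks) = G k (suc m) * sumFrom 0 (suc m) (λ m' → coeffBlocks m' ks)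

  blocks : ℕ → Word → Maybe (List ℕ)
  blocks zero    []      = just []
  blocks (suc k) []      = nothing
  blocks k       (a ∷ w) = blocks (suc k) w
  blocks k       (b ∷ w) = mapMaybe (k ∷_) (blocks 0 w)

  -- u_m on words (words outside Ĥ^1 never occur below; they get 0)
  uWord : ℕ → Word → Carrier
  uWord m w with blocks 0 w
  ... | just ks = coeffBlocks m ks
  ... | nothing = 0#

  u : ℕ → H → Carrier
  u m []             = 0#
  u m ((s , w) ∷ xs) = s * uWord m w + u m xs

  z : ℕ → H → Carrier
  z n x = sumRange 1 (n ∸ 1) (λ m → u m x)

  rhs : ℕ → List ℕ → ℕ → Carrier
  rhs n ks kr = pow (- 1#) kr *
    sumRange 1 kr (λ j → natK ((kr ∸ 1) C (j ∸ 1)) * pow ħ (kr ∸ j) * z n (aPow j (shuffleE ks)))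

module Submission where

-- At q = ζ the coefficients of t^m, 0 < m < n, of 𝓛 can be computed letter by letter: a
-- multiplies the coefficient of t^m by F̂(m) = F_{\hat1}(m), and b replaces a coefficient
-- sequence by its strict partial sums. Since [m] is invertible for 0 < m < n, F̂(m) + ħ = 1/[m]
-- and F̂(i+j)(F̂(i) + F̂(j) + ħ) = F̂(i)F̂(j), which is exactly what makes this evaluation turn
-- the ħ-shuffle into the Cauchy product of coefficient sequences. Hence the coefficients of
-- a^j(e_{k_1} ⧢ … ⧢ e_{k_{r-1}}) are F̂(m)^j ω_m(k_1,…,k_{r-1}), and the binomial theorem sums
-- the right-hand side to Σ_{0<m<n} ω_m(k_1,…,k_{r-1}) (-1)^{k_r} F̂(m) [m]^{1-k_r}.
-- The left-hand side is the convolution Σ_m ω_m(k_1,…,k_{r-1}) F_{k_r}(n - m), and at a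
-- primitive n-th root [n - m] = -q^{-m}[m], so F_{k_r}(n - m) = (-1)^{k_r} F̂(m) [m]^{1-k_r}.

open import Defs
open import Level using (Level)
open import Algebra.Bundles using (CommutativeRing)
open import Data.Nat using (ℕ; zero; suc; _∸_; _≤_; _<_; z≤n; s≤s)
  renaming (_+_ to _+ℕ_; _*_ to _*ℕ_)
import Data.Nat.Properties as ℕ
open import Data.Nat.Properties using (≤-refl; ≤-trans; ≤-<-trans; <-trans; m∸n≤m; m+[n∸m]≡n)
open import Data.Nat.Combinatorics using (_C_)
open import Data.Fin using (Fin; toℕ; inject₁; fromℕ)
open import Data.Fin.Properties using (toℕ≤pred[n]; toℕ<n; toℕ-inject₁; toℕ-fromℕ)
open import Data.List using (List; []; _∷_; _++_; concatMap; length; _∷ʳ_)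
open import Data.List.Relation.Unary.All using (All; []; _∷_)
import Data.List.Relation.Unary.All as All
open import Data.List.Relation.Unary.All.Properties using (map⁺; ++⁺; concat⁺)
open import Data.Maybe using (Maybe; just; nothing; maybe′)
import Data.Maybe as Maybe
open import Data.Product using (_×_; _,_; proj₁; proj₂)
open import Function using (_∘_)
open import Relation.Nullary using (¬_)
import Relation.Binary.PropositionalEquality as ≡
open ≡ using (_≡_)

module Convolution {c ℓ} (R : CommutativeRing c ℓ) where
  open CommutativeRing R
  open import Algebra.Properties.Semiring.Sum semiring
  open import Relation.Binary.Reasoning.Setoid setoid
  open import Algebra.Properties.CommutativeSemigroup *-commutativeSemigroup using (x∙yz≈y∙xz)
  open import Algebra.Solver.Ring.NaturalCoefficients commutativeSemiring (λ _ _ → nothing)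
    using (solve; _:+_; _:*_; _:=_)

  Seq : Set c
  Seq = ℕ → Carrier

  infixl 6 _⊕_
  infixl 7 _·_ _⊙_ _∗_

  _⊕_ : Seq → Seq → Seq
  (f ⊕ g) m = f m + g m

  _·_ : Carrier → Seq → Seq
  (s · f) m = s * f m

  _⊙_ : Seq → Seq → Seq
  (f ⊙ g) m = f m * g m

  -- Splitting off i = 0 is definitional: (f ∗ g) (suc m) = f 0 * g (suc m) + ((f ∘ suc) ∗ g) m.
  _∗_ : Seq → Seq → Seq
  (f ∗ g) m = ∑[ i < suc m ] (f (toℕ i) * g (m ∸ toℕ i))

  δ : Seq
  δ zero    = 1#
  δ (suc _) = 0#

  partialSums : Seq → Seq
  partialSums f m = ∑[ i < m ] f (toℕ i)

  infix 4 _≈[<_]_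
  _≈[<_]_ : Seq → ℕ → Seq → Set ℓ
  f ≈[< n ] g = ∀ {m} → m < n → f m ≈ g m

  ∗-cong-< : ∀ {n f f' g g'} → f ≈[< n ] f' → g ≈[< n ] g' → f ∗ g ≈[< n ] f' ∗ g'
  ∗-cong-< f≈f' g≈g' {m} m<n = sum-cong-≋ {suc m} λ i →
    *-cong (f≈f' (≤-<-trans (toℕ≤pred[n] i) m<n)) (g≈g' (≤-<-trans (m∸n≤m m (toℕ i)) m<n))

  ∗-congˡ : ∀ {f f'} g → (∀ i → f i ≈ f' i) → ∀ m → (f ∗ g) m ≈ (f' ∗ g) m
  ∗-congˡ g f≈f' m = sum-cong-≋ {suc m} λ i → *-congʳ {g (m ∸ toℕ i)} (f≈f' (toℕ i))

  ∗-congʳ : ∀ f {g g'} → (∀ i → g i ≈ g' i) → ∀ m → (f ∗ g) m ≈ (f ∗ g') m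
  ∗-congʳ f g≈g' m = sum-cong-≋ {suc m} λ i → *-congˡ {f (toℕ i)} (g≈g' (m ∸ toℕ i))

  partialSums-cong-< : ∀ {n f g} → f ≈[< n ] g → partialSums f ≈[< n ] partialSums g
  partialSums-cong-< f≈g {suc m} m<n = sum-cong-≋ {suc m} λ i → f≈g (<-trans (toℕ<n i) m<n)
  partialSums-cong-< f≈g {zero}  _   = refl

  partialSums-suc : ∀ f m → partialSums f (suc m) ≈ partialSums f m + f m
  partialSums-suc f m = begin
    ∑[ i < suc m ] f (toℕ i)                      ≈⟨ sum-init-last (λ i → f (toℕ i)) ⟩
    ∑[ i < m ] f (toℕ (inject₁ i)) + f (toℕ (fromℕ m))
      ≡⟨ ≡.cong₂ _+_ (sum-cong-≗ {m} λ i → ≡.cong f (toℕ-inject₁ i)) (≡.cong f (toℕ-fromℕ m)) ⟩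
    partialSums f m + f m                         ∎

  partialSums-⊕ : ∀ f g m → partialSums (f ⊕ g) m ≈ partialSums f m + partialSums g m
  partialSums-⊕ f g m = ∑-distrib-+ {m} (λ i → f (toℕ i)) (λ i → g (toℕ i))

  partialSums-· : ∀ s f m → partialSums (s · f) m ≈ s * partialSums f m
  partialSums-· s f m = sym (*-distribˡ-sum {m} s (λ i → f (toℕ i)))

  partialSums-zero : ∀ m → partialSums (λ _ → 0#) m ≈ 0#
  partialSums-zero = sum-replicate-zero

  ∗-distribʳ-⊕ : ∀ f f' g m → ((f ⊕ f') ∗ g) m ≈ (f ∗ g) m + (f' ∗ g) m
  ∗-distribʳ-⊕ f f' g m = trans (sum-cong-≋ {suc m} λ i → distribʳ (g (m ∸ toℕ i)) (f (toℕ i)) (f' (toℕ i)))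
    (∑-distrib-+ {suc m} (λ i → f (toℕ i) * g (m ∸ toℕ i)) (λ i → f' (toℕ i) * g (m ∸ toℕ i)))

  ∗-distribˡ-⊕ : ∀ f g g' m → (f ∗ (g ⊕ g')) m ≈ (f ∗ g) m + (f ∗ g') m
  ∗-distribˡ-⊕ f g g' m = trans (sum-cong-≋ {suc m} λ i → distribˡ (f (toℕ i)) (g (m ∸ toℕ i)) (g' (m ∸ toℕ i)))
    (∑-distrib-+ {suc m} (λ i → f (toℕ i) * g (m ∸ toℕ i)) (λ i → f (toℕ i) * g' (m ∸ toℕ i)))

  ∗-scaleˡ : ∀ s f g m → ((s · f) ∗ g) m ≈ s * (f ∗ g) m
  ∗-scaleˡ s f g m = trans (sum-cong-≋ {suc m} λ i → *-assoc s (f (toℕ i)) (g (m ∸ toℕ i)))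
    (sym (*-distribˡ-sum {suc m} s (λ i → f (toℕ i) * g (m ∸ toℕ i))))

  ∗-scaleʳ : ∀ s f g m → (f ∗ (s · g)) m ≈ s * (f ∗ g) m
  ∗-scaleʳ s f g m = trans (sum-cong-≋ {suc m} λ i → x∙yz≈y∙xz (f (toℕ i)) s (g (m ∸ toℕ i)))
    (sym (*-distribˡ-sum {suc m} s (λ i → f (toℕ i) * g (m ∸ toℕ i))))

  ∗-zeroˡ : ∀ g m → ((λ _ → 0#) ∗ g) m ≈ 0#
  ∗-zeroˡ g m = trans (sum-cong-≋ {suc m} λ i → zeroˡ (g (m ∸ toℕ i))) (sum-replicate-zero (suc m))

  ∗-zeroʳ : ∀ f m → (f ∗ (λ _ → 0#)) m ≈ 0#
  ∗-zeroʳ f m = trans (sum-cong-≋ {suc m} λ i → zeroʳ (f (toℕ i))) (sum-replicate-zero (suc m))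

  ∗-identityˡ : ∀ g m → (δ ∗ g) m ≈ g m
  ∗-identityˡ g m = begin
    1# * g m + ∑[ i < m ] (0# * g (m ∸ suc (toℕ i)))  ≈⟨ +-cong (*-identityˡ (g m)) (sum-cong-≋ {m} λ i → zeroˡ _) ⟩
    g m + ∑[ i < m ] 0#                                ≈⟨ +-congˡ (sum-replicate-zero m) ⟩
    g m + 0#                                           ≈⟨ +-identityʳ (g m) ⟩
    g m                                                ∎

  ∗-identityʳ : ∀ f m → (f ∗ δ) m ≈ f m
  ∗-identityʳ f zero    = trans (+-identityʳ _) (*-identityʳ (f 0))
  ∗-identityʳ f (suc m) = trans (+-cong (zeroʳ (f 0)) (∗-identityʳ (λ i → f (suc i)) m)) (+-identityˡ (f (suc m)))

  partialSums-∗ˡ : ∀ f g m → (partialSums f ∗ g) m ≈ partialSums (f ∗ g) m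
  partialSums-∗ˡ f g zero    = trans (+-identityʳ _) (zeroˡ (g 0))
  partialSums-∗ˡ f g (suc m) = begin
    0# * g (suc m) + ((λ i → partialSums f (suc i)) ∗ g) m
      ≈⟨ +-cong (zeroˡ (g (suc m))) (∗-congˡ g (partialSums-suc f) m) ⟩
    0# + ((partialSums f ⊕ f) ∗ g) m            ≈⟨ +-identityˡ _ ⟩
    ((partialSums f ⊕ f) ∗ g) m                 ≈⟨ ∗-distribʳ-⊕ (partialSums f) f g m ⟩
    (partialSums f ∗ g) m + (f ∗ g) m           ≈⟨ +-congʳ (partialSums-∗ˡ f g m) ⟩
    partialSums (f ∗ g) m + (f ∗ g) m           ≈⟨ partialSums-suc (f ∗ g) m ⟨
    partialSums (f ∗ g) (suc m)                 ∎

  partialSums-∗ʳ : ∀ f g m → (f ∗ partialSums g) m ≈ partialSums (f ∗ g) m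
  partialSums-∗ʳ f g zero    = trans (+-identityʳ _) (zeroʳ (f 0))
  partialSums-∗ʳ f g (suc m) = begin
    f 0 * (g 0 + G) + ((λ i → f (suc i)) ∗ partialSums g) m
      ≈⟨ +-congˡ (partialSums-∗ʳ (λ i → f (suc i)) g m) ⟩
    f 0 * (g 0 + G) + T                                ≈⟨ solve 4 (λ f₀ g₀ G T → f₀ :* (g₀ :+ G) :+ T := f₀ :* g₀ :+ (f₀ :* G :+ T)) refl (f 0) (g 0) G T ⟩
    f 0 * g 0 + (f 0 * G + T)                          ≈⟨ +-congʳ (+-identityʳ (f 0 * g 0)) ⟨
    (f 0 * g 0 + 0#) + (f 0 * G + T)                   ≈⟨ +-congˡ (+-congʳ (*-distribˡ-sum {m} (f 0) (λ i → g (suc (toℕ i))))) ⟩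
    (f 0 * g 0 + 0#) + (∑[ i < m ] (f 0 * g (suc (toℕ i))) + T)
      ≈⟨ +-congˡ (∑-distrib-+ {m} (λ i → f 0 * g (suc (toℕ i))) (λ i → ((λ j → f (suc j)) ∗ g) (toℕ i))) ⟨
    partialSums (f ∗ g) (suc m)                        ∎
    where
    G = ∑[ i < m ] g (suc (toℕ i))
    T = partialSums ((λ i → f (suc i)) ∗ g) m

  ∗-assoc : ∀ f g h m → (f ∗ (g ∗ h)) m ≈ ((f ∗ g) ∗ h) m
  ∗-assoc f g h zero    = begin
    f 0 * (g 0 * h 0 + 0#) + 0#   ≈⟨ trans (+-identityʳ _) (*-congˡ (+-identityʳ _)) ⟩
    f 0 * (g 0 * h 0)             ≈⟨ *-assoc (f 0) (g 0) (h 0) ⟨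
    (f 0 * g 0) * h 0             ≈⟨ trans (+-identityʳ _) (*-congʳ (+-identityʳ _)) ⟨
    (f 0 * g 0 + 0#) * h 0 + 0#   ∎
  ∗-assoc f g h (suc m) = begin
    f 0 * (g 0 * h (suc m) + A) + (f⁺ ∗ (g ∗ h)) m      ≈⟨ +-congˡ (∗-assoc f⁺ g h m) ⟩
    f 0 * (g 0 * h (suc m) + A) + B                     ≈⟨ solve 5 (λ f₀ g₀ h₁ A B → f₀ :* (g₀ :* h₁ :+ A) :+ B := f₀ :* g₀ :* h₁ :+ (f₀ :* A :+ B)) refl (f 0) (g 0) (h (suc m)) A B ⟩
    f 0 * g 0 * h (suc m) + (f 0 * A + B)               ≈⟨ +-congʳ (*-congʳ (+-identityʳ (f 0 * g 0))) ⟨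
    (f 0 * g 0 + 0#) * h (suc m) + (f 0 * A + B)        ≈⟨ +-congˡ (+-congʳ (∗-scaleˡ (f 0) g⁺ h m)) ⟨
    (f 0 * g 0 + 0#) * h (suc m) + (((f 0 · g⁺) ∗ h) m + B) ≈⟨ +-congˡ (∗-distribʳ-⊕ (f 0 · g⁺) (f⁺ ∗ g) h m) ⟨
    ((f ∗ g) ∗ h) (suc m)                               ∎
    where
    f⁺ g⁺ : Seq
    f⁺ i = f (suc i)
    g⁺ i = g (suc i)
    A = (g⁺ ∗ h) m
    B = ((f⁺ ∗ g) ∗ h) m

  -- The clause a w ⧢ a w′ = a (a w ⧢ w′ + w ⧢ a w′ + ħ w ⧢ w′) of the ħ-shuffle, evaluated.
  ⊙-∗-leibniz : ∀ (φ : Seq) ħ f g m →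
    (∀ i j → suc i +ℕ suc j ≡ m → φ m * (φ (suc i) + (φ (suc j) + ħ)) ≈ φ (suc i) * φ (suc j)) →
    f 0 ≈ 0# → g 0 ≈ 0# →
    φ m * (((φ ⊙ f) ∗ g) m + ((f ∗ (φ ⊙ g)) m + ħ * (f ∗ g) m)) ≈ ((φ ⊙ f) ∗ (φ ⊙ g)) m
  ⊙-∗-leibniz φ ħ f g m twist f₀≈0 g₀≈0 = begin
    φ m * (∑[ i < suc m ] t₁ i + (∑[ i < suc m ] t₂ i + ħ * ∑[ i < suc m ] t₃ i))
      ≈⟨ *-congˡ (+-congˡ (+-congˡ (*-distribˡ-sum {suc m} ħ t₃))) ⟩
    φ m * (∑[ i < suc m ] t₁ i + (∑[ i < suc m ] t₂ i + ∑[ i < suc m ] (ħ * t₃ i)))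
      ≈⟨ *-congˡ (+-congˡ (∑-distrib-+ {suc m} t₂ (λ i → ħ * t₃ i))) ⟨
    φ m * (∑[ i < suc m ] t₁ i + ∑[ i < suc m ] (t₂ i + ħ * t₃ i))
      ≈⟨ *-congˡ (∑-distrib-+ {suc m} t₁ (λ i → t₂ i + ħ * t₃ i)) ⟨
    φ m * ∑[ i < suc m ] (t₁ i + (t₂ i + ħ * t₃ i))
      ≈⟨ *-distribˡ-sum {suc m} (φ m) (λ i → t₁ i + (t₂ i + ħ * t₃ i)) ⟩
    ∑[ i < suc m ] (φ m * (t₁ i + (t₂ i + ħ * t₃ i)))
      ≈⟨ sum-cong-≋ {suc m} (λ i → termwise (toℕ i) (toℕ≤pred[n] i)) ⟩
    ((φ ⊙ f) ∗ (φ ⊙ g)) m ∎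
    where
    t₁ t₂ t₃ : Fin (suc m) → Carrier
    t₁ i = φ (toℕ i) * f (toℕ i) * g (m ∸ toℕ i)
    t₂ i = f (toℕ i) * (φ (m ∸ toℕ i) * g (m ∸ toℕ i))
    t₃ i = f (toℕ i) * g (m ∸ toℕ i)

    vanishing : ∀ {u x y} → u ≈ 0# → u * x ≈ u * y
    vanishing {u} {x} {y} u≈0 = trans (trans (*-congʳ u≈0) (zeroˡ x)) (sym (trans (*-congʳ u≈0) (zeroˡ y)))

    coefficient : ∀ i → i ≤ m →
      f i * g (m ∸ i) * (φ m * (φ i + (φ (m ∸ i) + ħ))) ≈ f i * g (m ∸ i) * (φ i * φ (m ∸ i))
    coefficient zero    _ = vanishing (trans (*-congʳ f₀≈0) (zeroˡ (g m)))
    coefficient (suc i) i≤m with m ∸ suc i in eq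
    ... | zero  = vanishing (trans (*-congˡ g₀≈0) (zeroʳ (f (suc i))))
    ... | suc j = *-congˡ (twist i j (≡.trans (≡.cong (suc i +ℕ_) (≡.sym eq)) (m+[n∸m]≡n i≤m)))

    termwise : ∀ i → i ≤ m →
      φ m * (φ i * f i * g (m ∸ i) + (f i * (φ (m ∸ i) * g (m ∸ i)) + ħ * (f i * g (m ∸ i))))
        ≈ φ i * f i * (φ (m ∸ i) * g (m ∸ i))
    termwise i i≤m = begin
      φ m * (φ i * f i * g (m ∸ i) + (f i * (φ (m ∸ i) * g (m ∸ i)) + ħ * (f i * g (m ∸ i))))
        ≈⟨ solve 6 (λ φₘ φᵢ φⱼ h fᵢ gⱼ → φₘ :* (φᵢ :* fᵢ :* gⱼ :+ (fᵢ :* (φⱼ :* gⱼ) :+ h :* (fᵢ :* gⱼ)))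
                                  := fᵢ :* gⱼ :* (φₘ :* (φᵢ :+ (φⱼ :+ h))))
                 refl (φ m) (φ i) (φ (m ∸ i)) ħ (f i) (g (m ∸ i)) ⟩
      f i * g (m ∸ i) * (φ m * (φ i + (φ (m ∸ i) + ħ)))  ≈⟨ coefficient i i≤m ⟩
      f i * g (m ∸ i) * (φ i * φ (m ∸ i))
        ≈⟨ solve 4 (λ fᵢ gⱼ φᵢ φⱼ → fᵢ :* gⱼ :* (φᵢ :* φⱼ) := φᵢ :* fᵢ :* (φⱼ :* gⱼ)) refl (f i) (g (m ∸ i)) (φ i) (φ (m ∸ i)) ⟩
      φ i * f i * (φ (m ∸ i) * g (m ∸ i)) ∎

module FieldProperties {c ℓ} (K : Field c ℓ) where
  open Field K
  open FieldOps K
  open import Algebra.Properties.Ring ring using (-1*x≈-x)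
  open import Algebra.Properties.Semiring.Sum semiring
  open import Algebra.Properties.CommutativeSemiring.Exp commutativeSemiring
    using (_^_; ^-homo-*; ^-assocʳ; ^-distrib-*)
  import Algebra.Properties.CommutativeSemiring.Binomial commutativeSemiring as Binomial
  open import Relation.Binary.Reasoning.Setoid setoid
  open import Algebra.Solver.Ring.NaturalCoefficients commutativeSemiring (λ _ _ → nothing)
    using (solve; _:*_; _:=_)

  ⁻¹-unique : ∀ {x y} → x * y ≈ 1# → x ⁻¹ ≈ y
  ⁻¹-unique {x} {y} xy≈1 = begin
    x ⁻¹              ≈⟨ *-identityʳ (x ⁻¹) ⟨
    x ⁻¹ * 1#         ≈⟨ *-congˡ xy≈1 ⟨
    x ⁻¹ * (x * y)    ≈⟨ *-assoc (x ⁻¹) x y ⟨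
    (x ⁻¹ * x) * y    ≈⟨ *-congʳ (trans (*-comm (x ⁻¹) x) (⁻¹-inverse x x≉0)) ⟩
    1# * y            ≈⟨ *-identityˡ y ⟩
    y                 ∎
    where
    x≉0 : ¬ x ≈ 0#
    x≉0 x≈0 = 0≉1 (trans (sym (trans (*-congʳ x≈0) (zeroˡ y))) xy≈1)

  *-cancelˡ-≈0 : ∀ {x y} → ¬ x ≈ 0# → x * y ≈ 0# → y ≈ 0#
  *-cancelˡ-≈0 {x} {y} x≉0 xy≈0 = begin
    y                 ≈⟨ *-identityˡ y ⟨
    1# * y            ≈⟨ *-congʳ (trans (*-comm (x ⁻¹) x) (⁻¹-inverse x x≉0)) ⟨
    (x ⁻¹ * x) * y    ≈⟨ *-assoc (x ⁻¹) x y ⟩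
    x ⁻¹ * (x * y)    ≈⟨ *-congˡ xy≈0 ⟩
    x ⁻¹ * 0#         ≈⟨ zeroʳ (x ⁻¹) ⟩
    0#                ∎

  pow≡^ : ∀ x k → pow x k ≡ x ^ k
  pow≡^ x zero    = ≡.refl
  pow≡^ x (suc k) = ≡.cong (x *_) (pow≡^ x k)

  sumFrom≡∑ : ∀ lo len f → sumFrom lo len f ≡ ∑[ i < len ] f (lo +ℕ toℕ i)
  sumFrom≡∑ lo zero      f = ≡.refl
  sumFrom≡∑ lo (suc len) f = ≡.cong₂ _+_ (≡.cong f (≡.sym (ℕ.+-identityʳ lo)))
    (≡.trans (sumFrom≡∑ (suc lo) len f) (sum-cong-≗ {len} λ i → ≡.cong f (≡.sym (ℕ.+-suc lo (toℕ i)))))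

  pow-cong : ∀ {x y} k → x ≈ y → pow x k ≈ pow y k
  pow-cong zero    x≈y = refl
  pow-cong (suc k) x≈y = *-cong x≈y (pow-cong k x≈y)

  pow-homo-* : ∀ x i j → pow x (i +ℕ j) ≈ pow x i * pow x j
  pow-homo-* x i j rewrite pow≡^ x (i +ℕ j) | pow≡^ x i | pow≡^ x j = ^-homo-* x i j

  pow-distrib-* : ∀ x y k → pow (x * y) k ≈ pow x k * pow y k
  pow-distrib-* x y k rewrite pow≡^ (x * y) k | pow≡^ x k | pow≡^ y k = ^-distrib-* x y k

  pow-assocʳ : ∀ x m k → pow (pow x m) k ≈ pow x (m *ℕ k)
  pow-assocʳ x m k rewrite pow≡^ (pow x m) k | pow≡^ x m | pow≡^ x (m *ℕ k) = ^-assocʳ x m k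

  pow-neg : ∀ x k → pow (- x) k ≈ pow (- 1#) k * pow x k
  pow-neg x k = trans (pow-cong k (sym (-1*x≈-x x))) (pow-distrib-* (- 1#) x k)

  binomial : ∀ x y k →
    pow (x + y) k ≈ ∑[ i ≤ k ] (natK (k C toℕ i) * pow x (toℕ i) * pow y (k ∸ toℕ i))
  binomial x y k = begin
    pow (x + y) k                                              ≡⟨ pow≡^ (x + y) k ⟩
    (x + y) ^ k                                                ≈⟨ Binomial.theorem k x y ⟩
    ∑[ i ≤ k ] ((k C toℕ i) ×ₙ (x ^ toℕ i * y ^ (k ∸ toℕ i)))  ≈⟨ sum-cong-≋ {suc k} term ⟩
    ∑[ i ≤ k ] (natK (k C toℕ i) * pow x (toℕ i) * pow y (k ∸ toℕ i)) ∎
    where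
    open import Algebra.Properties.Semiring.Mult semiring using (×-congʳ; ×-assoc-*) renaming (_×_ to _×ₙ_)

    natK≡× : ∀ m → natK m ≡ m ×ₙ 1#
    natK≡× zero    = ≡.refl
    natK≡× (suc m) = ≡.cong (1# +_) (natK≡× m)

    term : ∀ i → (k C toℕ i) ×ₙ (x ^ toℕ i * y ^ (k ∸ toℕ i))
                   ≈ natK (k C toℕ i) * pow x (toℕ i) * pow y (k ∸ toℕ i)
    term i rewrite natK≡× (k C toℕ i) | pow≡^ x (toℕ i) | pow≡^ y (k ∸ toℕ i) = begin
      κ ×ₙ (x ^ toℕ i * y ^ (k ∸ toℕ i))         ≈⟨ ×-congʳ κ (*-identityˡ _) ⟨
      κ ×ₙ (1# * (x ^ toℕ i * y ^ (k ∸ toℕ i)))  ≈⟨ ×-assoc-* κ 1# _ ⟨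
      κ ×ₙ 1# * (x ^ toℕ i * y ^ (k ∸ toℕ i))    ≈⟨ *-assoc _ _ _ ⟨
      κ ×ₙ 1# * x ^ toℕ i * y ^ (k ∸ toℕ i)      ∎
      where κ = k C toℕ i

  binomial-shifted : ∀ x y k →
    ∑[ j ≤ k ] (natK (k C toℕ j) * pow y (k ∸ toℕ j) * pow x (suc (toℕ j))) ≈ x * pow (x + y) k
  binomial-shifted x y k = begin
    ∑[ j ≤ k ] (natK (k C toℕ j) * pow y (k ∸ toℕ j) * pow x (suc (toℕ j)))
      ≈⟨ sum-cong-≋ {suc k} (λ j → solve 4 (λ c h x p → c :* h :* (x :* p) := x :* (c :* p :* h)) refl
                                        (natK (k C toℕ j)) (pow y (k ∸ toℕ j)) x (pow x (toℕ j))) ⟩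
    ∑[ j ≤ k ] (x * (natK (k C toℕ j) * pow x (toℕ j) * pow y (k ∸ toℕ j)))
      ≈⟨ *-distribˡ-sum {suc k} x (λ j → natK (k C toℕ j) * pow x (toℕ j) * pow y (k ∸ toℕ j)) ⟨
    x * ∑[ j ≤ k ] (natK (k C toℕ j) * pow x (toℕ j) * pow y (k ∸ toℕ j))
      ≈⟨ *-congˡ (binomial x y k) ⟨
    x * pow (x + y) k ∎

  pow-neg-*-neg : ∀ x y k → pow (- x) k * - y ≈ pow (- 1#) (suc k) * (y * pow x k)
  pow-neg-*-neg x y k = begin
    pow (- x) k * - y                        ≈⟨ *-cong (pow-neg x k) (sym (-1*x≈-x y)) ⟩
    pow (- 1#) k * pow x k * (- 1# * y)      ≈⟨ solve 4 (λ s p m y → s :* p :* (m :* y) := m :* s :* (y :* p)) refl (pow (- 1#) k) (pow x k) (- 1#) y ⟩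
    - 1# * pow (- 1#) k * (y * pow x k)      ∎

-- The words spanning 𝔥¹ = C ⊕ 𝔥b; L turns the ħ-shuffle into ∗ only on these.
data Admissible : Word → Set where
  []  : Admissible []
  b∷_ : ∀ {w} → Admissible w → Admissible (b ∷ w)
  a∷_ : ∀ {l w} → Admissible (l ∷ w) → Admissible (a ∷ l ∷ w)

module QSeries {c ℓ} (K : Field c ℓ) (ζ : Field.Carrier K) where
  open Field K
  open AtRoot K ζ
  open FieldProperties K
  open Convolution commutativeRing public
  open import Algebra.Properties.Semiring.Sum semiring
  open import Algebra.Properties.CommutativeSemigroup *-commutativeSemigroup
    using (x∙yz≈y∙xz; x∙yz≈xz∙y)
  open import Relation.Binary.Reasoning.Setoid setoid
  open import Algebra.Solver.Ring.NaturalCoefficients commutativeSemiring (λ _ _ → nothing)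
    using (solve; _:+_; _:*_; _:=_; con)

  ħ+q≈1 : ħ + q ≈ 1#
  ħ+q≈1 = trans (+-assoc 1# (- q) q) (trans (+-congˡ (-‿inverseˡ q)) (+-identityʳ 1#))

  qint-suc : ∀ m → qint (suc m) ≈ 1# + q * qint m
  qint-suc m = +-congˡ (begin
    sumFrom 1 m (pow q)             ≡⟨ sumFrom≡∑ 1 m (pow q) ⟩
    ∑[ i < m ] (q * pow q (toℕ i))  ≈⟨ *-distribˡ-sum {m} q (λ i → pow q (toℕ i)) ⟨
    q * ∑[ i < m ] pow q (toℕ i)    ≡⟨ ≡.cong (q *_) (sumFrom≡∑ 0 m (pow q)) ⟨
    q * qint m                      ∎)

  q^m+ħ[m]≈1 : ∀ m → pow q m + ħ * qint m ≈ 1#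
  q^m+ħ[m]≈1 zero    = trans (+-congˡ (zeroʳ ħ)) (+-identityʳ 1#)
  q^m+ħ[m]≈1 (suc m) = begin
    q * pow q m + ħ * qint (suc m)       ≈⟨ +-congˡ (*-congˡ (qint-suc m)) ⟩
    q * pow q m + ħ * (1# + q * qint m)  ≈⟨ solve 4 (λ q p h r → q :* p :+ h :* (con 1 :+ q :* r) := q :* (p :+ h :* r) :+ h) refl q (pow q m) ħ (qint m) ⟩
    q * (pow q m + ħ * qint m) + ħ       ≈⟨ +-congʳ (trans (*-congˡ (q^m+ħ[m]≈1 m)) (*-identityʳ q)) ⟩
    q + ħ                                ≈⟨ trans (+-comm q ħ) ħ+q≈1 ⟩
    1#                                   ∎

  [i+j]≈[i]+q^i[j] : ∀ i j → qint (i +ℕ j) ≈ qint i + pow q i * qint j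
  [i+j]≈[i]+q^i[j] zero    j = sym (trans (+-identityˡ _) (*-identityˡ _))
  [i+j]≈[i]+q^i[j] (suc i) j = begin
    qint (suc (i +ℕ j))                         ≈⟨ qint-suc (i +ℕ j) ⟩
    1# + q * qint (i +ℕ j)                      ≈⟨ +-congˡ (*-congˡ ([i+j]≈[i]+q^i[j] i j)) ⟩
    1# + q * (qint i + pow q i * qint j)        ≈⟨ solve 4 (λ q a p b → con 1 :+ q :* (a :+ p :* b) := (con 1 :+ q :* a) :+ (q :* p) :* b) refl q (qint i) (pow q i) (qint j) ⟩
    (1# + q * qint i) + (q * pow q i) * qint j  ≈⟨ +-congʳ (qint-suc i) ⟨
    qint (suc i) + pow q (suc i) * qint j       ∎

  [_]⁻¹ : ℕ → Carrier
  [ m ]⁻¹ = qint m ⁻¹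

  Fk≈Fhat^k[m]⁻¹ : ∀ k m → Fk (suc k) m ≈ pow (Fhat m) k * [ m ]⁻¹
  Fk≈Fhat^k[m]⁻¹ k m = begin
    pow q (k *ℕ m) * ([ m ]⁻¹ * pow [ m ]⁻¹ k)      ≡⟨ ≡.cong (λ e → pow q e * ([ m ]⁻¹ * pow [ m ]⁻¹ k)) (ℕ.*-comm k m) ⟩
    pow q (m *ℕ k) * ([ m ]⁻¹ * pow [ m ]⁻¹ k)      ≈⟨ *-congʳ (pow-assocʳ q m k) ⟨
    pow (pow q m) k * ([ m ]⁻¹ * pow [ m ]⁻¹ k)     ≈⟨ x∙yz≈xz∙y (pow (pow q m) k) [ m ]⁻¹ (pow [ m ]⁻¹ k) ⟩
    (pow (pow q m) k * pow [ m ]⁻¹ k) * [ m ]⁻¹     ≈⟨ *-congʳ (pow-distrib-* (pow q m) [ m ]⁻¹ k) ⟨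
    pow (Fhat m) k * [ m ]⁻¹                        ∎

  -- F̂ and F_k, with the junk values at 0 (where [0]⁻¹ = 0⁻¹) replaced by 0.
  φ : Seq
  φ zero    = 0#
  φ (suc m) = Fhat (suc m)

  F : ℕ → Seq
  F k zero    = 0#
  F k (suc m) = Fk k (suc m)

  F-pos : ∀ k {m} → 1 ≤ m → F k m ≡ Fk k m
  F-pos k {suc m} _ = ≡.refl

  omega-[] : ∀ m → omega m [] ≡ δ m
  omega-[] zero    = ≡.refl
  omega-[] (suc m) = ≡.refl

  omega-∷ : ∀ k ks m → omega m (k ∷ ks) ≈ (F k ∗ (λ i → omega i ks)) m
  omega-∷ k ks zero    = sym (trans (+-identityʳ _) (zeroˡ _))
  omega-∷ k ks (suc m) = begin
    sumFrom 1 (suc m) (λ j → Fk k j * omega (suc m ∸ j) ks)             ≡⟨ sumFrom≡∑ 1 (suc m) _ ⟩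
    ∑[ i < suc m ] (Fk k (suc (toℕ i)) * omega (m ∸ toℕ i) ks)          ≈⟨ +-identityˡ _ ⟨
    0# + ∑[ i < suc m ] (Fk k (suc (toℕ i)) * omega (m ∸ toℕ i) ks)     ≈⟨ +-congʳ (zeroˡ _) ⟨
    (F k ∗ (λ i → omega i ks)) (suc m)                                  ∎

  omega-∷ʳ : ∀ ks k m → omega m (ks ∷ʳ k) ≈ ((λ i → omega i ks) ∗ F k) m
  omega-∷ʳ []        k m = begin
    omega m (k ∷ [])                 ≈⟨ omega-∷ k [] m ⟩
    (F k ∗ (λ i → omega i [])) m     ≈⟨ ∗-congʳ (F k) (λ i → reflexive (omega-[] i)) m ⟩
    (F k ∗ δ) m                      ≈⟨ ∗-identityʳ (F k) m ⟩
    F k m                            ≈⟨ ∗-identityˡ (F k) m ⟨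
    (δ ∗ F k) m                      ≈⟨ ∗-congˡ (F k) (λ i → reflexive (omega-[] i)) m ⟨
    ((λ i → omega i []) ∗ F k) m     ∎
  omega-∷ʳ (k′ ∷ ks) k m = begin
    omega m (k′ ∷ (ks ∷ʳ k))                          ≈⟨ omega-∷ k′ (ks ∷ʳ k) m ⟩
    (F k′ ∗ (λ i → omega i (ks ∷ʳ k))) m              ≈⟨ ∗-congʳ (F k′) (λ i → omega-∷ʳ ks k i) m ⟩
    (F k′ ∗ ((λ i → omega i ks) ∗ F k)) m             ≈⟨ ∗-assoc (F k′) (λ i → omega i ks) (F k) m ⟩
    ((F k′ ∗ (λ i → omega i ks)) ∗ F k) m             ≈⟨ ∗-congˡ (F k) (λ i → omega-∷ k′ ks i) m ⟨
    ((λ i → omega i (k′ ∷ ks)) ∗ F k) m               ∎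

  -- At a primitive n-th root, L w m is the coefficient of t^m in 𝓛(w) for m < n (u≈Lᴴ).
  L : Word → Seq
  L []      = δ
  L (a ∷ w) = φ ⊙ L w
  L (b ∷ w) = partialSums (L w)

  extend : (Word → Seq) → H → Seq
  extend V []             = λ _ → 0#
  extend V ((s , w) ∷ xs) = s · V w ⊕ extend V xs

  Lᴴ : H → Seq
  Lᴴ = extend L

  L-∷-zero : ∀ l w → L (l ∷ w) 0 ≈ 0#
  L-∷-zero a w = zeroˡ (L w 0)
  L-∷-zero b w = refl

  L-aᵏ : ∀ k w m → L (as k ++ w) m ≈ pow (φ m) k * L w m
  L-aᵏ zero    w m = sym (*-identityˡ (L w m))
  L-aᵏ (suc k) w m = trans (*-congˡ (L-aᵏ k w m)) (sym (*-assoc (φ m) _ _))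

  extend-++ : ∀ V xs ys m → extend V (xs ++ ys) m ≈ extend V xs m + extend V ys m
  extend-++ V []             ys m = sym (+-identityˡ _)
  extend-++ V ((s , w) ∷ xs) ys m = trans (+-congˡ (extend-++ V xs ys m)) (sym (+-assoc _ _ _))

  extend-scale : ∀ V t xs m → extend V (scale t xs) m ≈ t * extend V xs m
  extend-scale V t []             m = sym (zeroʳ t)
  extend-scale V t ((s , w) ∷ xs) m =
    trans (+-cong (*-assoc t s (V w m)) (extend-scale V t xs m)) (sym (distribˡ t _ _))

  extend-· : ∀ V t xs m → extend (λ w → t · V w) xs m ≈ t * extend V xs m
  extend-· V t []             m = sym (zeroʳ t)
  extend-· V t ((s , w) ∷ xs) m = trans (+-cong (x∙yz≈y∙xz s t (V w m)) (extend-· V t xs m)) (sym (distribˡ t _ _))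

  extend-∗ˡ : ∀ V g xs m → extend (λ w → V w ∗ g) xs m ≈ (extend V xs ∗ g) m
  extend-∗ˡ V g []             m = sym (∗-zeroˡ g m)
  extend-∗ˡ V g ((s , w) ∷ xs) m = begin
    s * (V w ∗ g) m + extend (λ w → V w ∗ g) xs m  ≈⟨ +-cong (sym (∗-scaleˡ s (V w) g m)) (extend-∗ˡ V g xs m) ⟩
    ((s · V w) ∗ g) m + (extend V xs ∗ g) m        ≈⟨ ∗-distribʳ-⊕ (s · V w) (extend V xs) g m ⟨
    ((s · V w ⊕ extend V xs) ∗ g) m                ∎

  extend-∗ʳ : ∀ V f xs m → extend (λ w → f ∗ V w) xs m ≈ (f ∗ extend V xs) m
  extend-∗ʳ V f []             m = sym (∗-zeroʳ f m)
  extend-∗ʳ V f ((s , w) ∷ xs) m = begin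
    s * (f ∗ V w) m + extend (λ w → f ∗ V w) xs m  ≈⟨ +-cong (sym (∗-scaleʳ s f (V w) m)) (extend-∗ʳ V f xs m) ⟩
    (f ∗ (s · V w)) m + (f ∗ extend V xs) m        ≈⟨ ∗-distribˡ-⊕ f (s · V w) (extend V xs) m ⟨
    (f ∗ (s · V w ⊕ extend V xs)) m                ∎

  extend-concatMap : ∀ {P : Word → Set} V (G : Carrier × Word → H) m →
    (∀ {s w} → P w → Lᴴ (G (s , w)) m ≈ s * V w m) →
    ∀ {xs} → All (P ∘ proj₂) xs → Lᴴ (concatMap G xs) m ≈ extend V xs m
  extend-concatMap V G m G≈ {[]}          []       = refl
  extend-concatMap V G m G≈ {(s , w) ∷ xs} (p ∷ ps) =
    trans (extend-++ L (G (s , w)) (concatMap G xs) m) (+-cong (G≈ p) (extend-concatMap V G m G≈ ps))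

  Lᴴ-prefix-a : ∀ xs m → Lᴴ (prefix a xs) m ≈ φ m * Lᴴ xs m
  Lᴴ-prefix-a []             m = sym (zeroʳ (φ m))
  Lᴴ-prefix-a ((s , w) ∷ xs) m = trans (+-congˡ (Lᴴ-prefix-a xs m))
    (solve 4 (λ s p u r → s :* (p :* u) :+ p :* r := p :* (s :* u :+ r)) refl s (φ m) (L w m) (Lᴴ xs m))

  Lᴴ-prefix-b : ∀ xs m → Lᴴ (prefix b xs) m ≈ partialSums (Lᴴ xs) m
  Lᴴ-prefix-b []             m = sym (partialSums-zero m)
  Lᴴ-prefix-b ((s , w) ∷ xs) m = begin
    s * partialSums (L w) m + Lᴴ (prefix b xs) m       ≈⟨ +-cong (sym (partialSums-· s (L w) m)) (Lᴴ-prefix-b xs m) ⟩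
    partialSums (s · L w) m + partialSums (Lᴴ xs) m    ≈⟨ partialSums-⊕ (s · L w) (Lᴴ xs) m ⟨
    partialSums (s · L w ⊕ Lᴴ xs) m                    ∎

  Lᴴ-aPow : ∀ j xs m → Lᴴ (aPow j xs) m ≈ pow (φ m) j * Lᴴ xs m
  Lᴴ-aPow zero    xs m = sym (*-identityˡ _)
  Lᴴ-aPow (suc j) xs m =
    trans (Lᴴ-prefix-a (aPow j xs) m) (trans (*-congˡ (Lᴴ-aPow j xs m)) (sym (*-assoc _ _ _)))

  AdmissibleTerms : H → Set c
  AdmissibleTerms = All (Admissible ∘ proj₂)

  mutual
    shw-admissible : ∀ {w w'} → Admissible w → Admissible w' → AdmissibleTerms (shw w w')
    shw-admissible []     p'      = p' ∷ []
    shw-admissible (b∷ p) p'      = map⁺ (All.map b∷_ (shw-admissible p p'))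
    shw-admissible (a∷ p) []      = a∷ p ∷ []
    shw-admissible (a∷ p) (b∷ p') = map⁺ (All.map b∷_ (shw-admissible (a∷ p) p'))
    shw-admissible q@(a∷ _) q'@(a∷ _) = map⁺ (a∷-shw-a∷ q q')

    a∷-shw-a∷ : ∀ {l w l' w'} → Admissible (a ∷ l ∷ w) → Admissible (a ∷ l' ∷ w') →
      All (λ t → Admissible (a ∷ proj₂ t))
        (shw (a ∷ l ∷ w) (l' ∷ w') ++ shw (l ∷ w) (a ∷ l' ∷ w') ++ scale ħ (shw (l ∷ w) (l' ∷ w')))
    a∷-shw-a∷ q@(a∷ p) q'@(a∷ p') = ++⁺ (a∷-shw q p') (++⁺ (a∷-shw p q') (map⁺ (a∷-shw p p')))

    a∷-shw : ∀ {l w w'} → Admissible (l ∷ w) → Admissible w' → All (λ t → Admissible (a ∷ proj₂ t)) (shw (l ∷ w) w')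
    a∷-shw (b∷ p) p'      = map⁺ (All.map (a∷_ ∘ b∷_) (shw-admissible p p'))
    a∷-shw (a∷ p) []      = a∷ a∷ p ∷ []
    a∷-shw (a∷ p) (b∷ p') = map⁺ (All.map (a∷_ ∘ b∷_) (shw-admissible (a∷ p) p'))
    a∷-shw q@(a∷ _) q'@(a∷ _) = map⁺ (All.map a∷_ (a∷-shw-a∷ q q'))

  sh-admissible : ∀ {xs ys} → AdmissibleTerms xs → AdmissibleTerms ys → AdmissibleTerms (sh xs ys)
  sh-admissible ps qs =
    concat⁺ (map⁺ (All.map (λ p → concat⁺ (map⁺ (All.map (λ q → map⁺ (shw-admissible p q)) qs))) ps))

  aᵏb-admissible : ∀ k → Admissible (as k ++ b ∷ [])
  aᵏb-admissible zero          = b∷ []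
  aᵏb-admissible (suc zero)    = a∷ b∷ []
  aᵏb-admissible (suc (suc k)) = a∷ aᵏb-admissible (suc k)

  e-admissible : ∀ k → AdmissibleTerms (e k)
  e-admissible k = aᵏb-admissible k ∷ aᵏb-admissible (k ∸ 1) ∷ []

  shuffleE-admissible : ∀ ks → AdmissibleTerms (shuffleE ks)
  shuffleE-admissible []       = [] ∷ []
  shuffleE-admissible (k ∷ ks) = sh-admissible (e-admissible k) (shuffleE-admissible ks)

module AtPrimitiveRoot {c ℓ} (K : Field c ℓ) (ζ : Field.Carrier K) (n : ℕ)
  (ζ-primitive : PrimitiveRoot K n ζ) where
  open Field K
  open AtRoot K ζ
  open QSeries K ζ
  open FieldProperties K
  open import Algebra.Properties.Ring ring
    using (xyx⁻¹≈y; +-inverseʳ-unique; -‿distribˡ-*; -‿distribʳ-*; -‿involutive)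
  open import Algebra.Properties.Semiring.Sum semiring
  open import Algebra.Properties.CommutativeSemigroup *-commutativeSemigroup
    using (xy∙z≈y∙xz; interchange)
  open import Relation.Binary.Reasoning.Setoid setoid
  open import Algebra.Solver.Ring.NaturalCoefficients commutativeSemiring (λ _ _ → nothing)
    using (solve; _:+_; _:*_; _:=_; con)

  private
    ζⁿ≈1 : pow q n ≈ 1#
    ζⁿ≈1 = proj₁ ζ-primitive

    ζᵐ≉1 : ∀ m → 1 ≤ m → m < n → ¬ pow q m ≈ 1#
    ζᵐ≉1 = proj₂ ζ-primitive

  ħ≉0 : 1 < n → ¬ ħ ≈ 0#
  ħ≉0 1<n ħ≈0 = ζᵐ≉1 1 ≤-refl 1<n (trans (*-identityʳ q) q≈1)
    where
    q≈1 : q ≈ 1#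
    q≈1 = trans (sym (+-identityˡ q)) (trans (+-congʳ (sym ħ≈0)) ħ+q≈1)

  [m]≉0 : ∀ {m} → 1 ≤ m → m < n → ¬ qint m ≈ 0#
  [m]≉0 {m} 1≤m m<n [m]≈0 = ζᵐ≉1 m 1≤m m<n (begin
    pow q m                  ≈⟨ +-identityʳ (pow q m) ⟨
    pow q m + 0#             ≈⟨ +-congˡ (trans (*-congˡ [m]≈0) (zeroʳ ħ)) ⟨
    pow q m + ħ * qint m     ≈⟨ q^m+ħ[m]≈1 m ⟩
    1#                       ∎)

  [m][m]⁻¹≈1 : ∀ {m} → 1 ≤ m → m < n → qint m * [ m ]⁻¹ ≈ 1#
  [m][m]⁻¹≈1 1≤m m<n = ⁻¹-inverse _ ([m]≉0 1≤m m<n)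

  [n]≈0 : 1 < n → qint n ≈ 0#
  [n]≈0 1<n = *-cancelˡ-≈0 (ħ≉0 1<n) (begin
    ħ * qint n                   ≈⟨ +-identityˡ _ ⟨
    0# + ħ * qint n              ≈⟨ +-congʳ (-‿inverseˡ (pow q n)) ⟨
    (- pow q n + pow q n) + ħ * qint n  ≈⟨ +-assoc _ _ _ ⟩
    - pow q n + (pow q n + ħ * qint n)  ≈⟨ +-cong (-‿cong ζⁿ≈1) (q^m+ħ[m]≈1 n) ⟩
    - 1# + 1#                    ≈⟨ -‿inverseˡ 1# ⟩
    0#                           ∎)

  Fhat+ħ≈[m]⁻¹ : ∀ {m} → 1 ≤ m → m < n → Fhat m + ħ ≈ [ m ]⁻¹
  Fhat+ħ≈[m]⁻¹ {m} 1≤m m<n = begin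
    pow q m * [ m ]⁻¹ + ħ                      ≈⟨ +-congˡ (trans (*-congˡ ([m][m]⁻¹≈1 1≤m m<n)) (*-identityʳ ħ)) ⟨
    pow q m * [ m ]⁻¹ + ħ * (qint m * [ m ]⁻¹) ≈⟨ solve 4 (λ p x h i → p :* x :+ h :* (i :* x) := (p :+ h :* i) :* x) refl (pow q m) [ m ]⁻¹ ħ (qint m) ⟩
    (pow q m + ħ * qint m) * [ m ]⁻¹           ≈⟨ *-congʳ (q^m+ħ[m]≈1 m) ⟩
    1# * [ m ]⁻¹                               ≈⟨ *-identityˡ _ ⟩
    [ m ]⁻¹                                    ∎

  G≈Fhat^k : ∀ k {m} → 1 ≤ m → m < n → G k m ≈ pow (Fhat m) k
  G≈Fhat^k zero {m} 1≤m m<n = begin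
    ħ ⁻¹ * (Fk 1 m - Fhat m)               ≈⟨ *-congˡ (+-congʳ (trans Fk1≈[m]⁻¹ (sym (Fhat+ħ≈[m]⁻¹ 1≤m m<n)))) ⟩
    ħ ⁻¹ * ((Fhat m + ħ) - Fhat m)         ≈⟨ *-congˡ (xyx⁻¹≈y (Fhat m) ħ) ⟩
    ħ ⁻¹ * ħ                               ≈⟨ trans (*-comm (ħ ⁻¹) ħ) (⁻¹-inverse ħ (ħ≉0 (≤-<-trans 1≤m m<n))) ⟩
    1#                                     ∎
    where
    Fk1≈[m]⁻¹ : Fk 1 m ≈ [ m ]⁻¹
    Fk1≈[m]⁻¹ = trans (*-identityˡ _) (*-identityʳ _)
  G≈Fhat^k (suc zero)    1≤m m<n = sym (*-identityʳ _)
  G≈Fhat^k (suc (suc k)) {m} 1≤m m<n = begin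
    Fk (suc (suc k)) m - ħ * G (suc k) m     ≈⟨ +-congˡ (-‿cong (*-congˡ (G≈Fhat^k (suc k) 1≤m m<n))) ⟩
    Fk (suc (suc k)) m - ħ * P               ≈⟨ +-congʳ (Fk≈Fhat^k[m]⁻¹ (suc k) m) ⟩
    P * [ m ]⁻¹ - ħ * P                      ≈⟨ +-congʳ (*-congˡ (sym (Fhat+ħ≈[m]⁻¹ 1≤m m<n))) ⟩
    P * (Fhat m + ħ) - ħ * P                 ≈⟨ +-congʳ (trans (distribˡ P (Fhat m) ħ) (+-cong (*-comm P (Fhat m)) (*-comm P ħ))) ⟩
    (Fhat m * P + ħ * P) - ħ * P             ≈⟨ +-assoc _ _ _ ⟩
    Fhat m * P + (ħ * P - ħ * P)             ≈⟨ +-congˡ (-‿inverseʳ (ħ * P)) ⟩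
    Fhat m * P + 0#                          ≈⟨ +-identityʳ _ ⟩
    Fhat m * P                               ∎
    where
    P = pow (Fhat m) (suc k)

  Fhat-twisted : ∀ {i j} → 1 ≤ i → 1 ≤ j → i +ℕ j < n →
    Fhat (i +ℕ j) * (Fhat i + (Fhat j + ħ)) ≈ Fhat i * Fhat j
  Fhat-twisted {i} {j} 1≤i 1≤j i+j<n = begin
    Fhat (i +ℕ j) * (Fhat i + (Fhat j + ħ))     ≈⟨ *-congˡ (+-congˡ (Fhat+ħ≈[m]⁻¹ 1≤j j<n)) ⟩
    Fhat (i +ℕ j) * (Fhat i + [ j ]⁻¹)          ≈⟨ *-congˡ [i+j][i]⁻¹[j]⁻¹ ⟨
    pow q (i +ℕ j) * [ i +ℕ j ]⁻¹ * ([ i ]⁻¹ * [ j ]⁻¹ * qint (i +ℕ j))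
      ≈⟨ solve 5 (λ p z x y r → p :* z :* (x :* y :* r) := p :* (x :* y) :* (r :* z)) refl (pow q (i +ℕ j)) [ i +ℕ j ]⁻¹ [ i ]⁻¹ [ j ]⁻¹ (qint (i +ℕ j)) ⟩
    pow q (i +ℕ j) * ([ i ]⁻¹ * [ j ]⁻¹) * (qint (i +ℕ j) * [ i +ℕ j ]⁻¹)
      ≈⟨ *-cong (*-congʳ (pow-homo-* q i j)) ([m][m]⁻¹≈1 (≤-trans 1≤i (ℕ.m≤m+n i j)) i+j<n) ⟩
    pow q i * pow q j * ([ i ]⁻¹ * [ j ]⁻¹) * 1#
      ≈⟨ solve 4 (λ p r x y → p :* r :* (x :* y) :* con 1 := (p :* x) :* (r :* y)) refl (pow q i) (pow q j) [ i ]⁻¹ [ j ]⁻¹ ⟩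
    Fhat i * Fhat j                             ∎
    where
    i<n : i < n
    i<n = ≤-<-trans (ℕ.m≤m+n i j) i+j<n
    j<n : j < n
    j<n = ≤-<-trans (ℕ.m≤n+m j i) i+j<n
    [i+j][i]⁻¹[j]⁻¹ : [ i ]⁻¹ * [ j ]⁻¹ * qint (i +ℕ j) ≈ Fhat i + [ j ]⁻¹
    [i+j][i]⁻¹[j]⁻¹ = begin
      [ i ]⁻¹ * [ j ]⁻¹ * qint (i +ℕ j)                   ≈⟨ *-congˡ ([i+j]≈[i]+q^i[j] i j) ⟩
      [ i ]⁻¹ * [ j ]⁻¹ * (qint i + pow q i * qint j)
        ≈⟨ solve 5 (λ x y a p b → x :* y :* (a :+ p :* b) := (a :* x) :* y :+ (p :* x) :* (b :* y)) refl [ i ]⁻¹ [ j ]⁻¹ (qint i) (pow q i) (qint j) ⟩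
      (qint i * [ i ]⁻¹) * [ j ]⁻¹ + Fhat i * (qint j * [ j ]⁻¹)
        ≈⟨ +-cong (*-congʳ ([m][m]⁻¹≈1 1≤i i<n)) (*-congˡ ([m][m]⁻¹≈1 1≤j j<n)) ⟩
      1# * [ j ]⁻¹ + Fhat i * 1#                          ≈⟨ trans (+-cong (*-identityˡ _) (*-identityʳ _)) (+-comm _ _) ⟩
      Fhat i + [ j ]⁻¹                                    ∎

  -- q^(n ∸ i) = q^-i, so [n ∸ i] = -q^-i [i].
  module Reflection {i} (1≤i : 1 ≤ i) (i<n : i < n) where
    private
      j = n ∸ i

      qʲqⁱ≈1 : pow q j * pow q i ≈ 1#
      qʲqⁱ≈1 = trans (sym (pow-homo-* q j i)) (trans (reflexive (≡.cong (pow q) (ℕ.m∸n+n≡m (ℕ.<⇒≤ i<n)))) ζⁿ≈1)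

      qⁱ[j]≈-[i] : pow q i * qint j ≈ - qint i
      qⁱ[j]≈-[i] = +-inverseʳ-unique (qint i) (pow q i * qint j)
        (trans (sym ([i+j]≈[i]+q^i[j] i j))
          (trans (reflexive (≡.cong qint (ℕ.m+[n∸m]≡n (ℕ.<⇒≤ i<n)))) ([n]≈0 (≤-<-trans 1≤i i<n))))

      [j]-Fhatᵢ≈1 : qint j * - Fhat i ≈ 1#
      [j]-Fhatᵢ≈1 = begin
        qint j * - Fhat i                             ≈⟨ *-congʳ (*-identityˡ (qint j)) ⟨
        1# * qint j * - Fhat i                        ≈⟨ *-congʳ (*-congʳ qʲqⁱ≈1) ⟨
        pow q j * pow q i * qint j * - Fhat i         ≈⟨ *-congʳ (*-assoc _ _ _) ⟩
        pow q j * (pow q i * qint j) * - Fhat i       ≈⟨ *-congʳ (*-congˡ qⁱ[j]≈-[i]) ⟩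
        pow q j * - qint i * - Fhat i                 ≈⟨ *-congʳ (-‿distribʳ-* _ _) ⟨
        - (pow q j * qint i) * - Fhat i               ≈⟨ -x*-y≈x*y _ _ ⟩
        pow q j * qint i * (pow q i * [ i ]⁻¹)
          ≈⟨ interchange (pow q j) (qint i) (pow q i) [ i ]⁻¹ ⟩
        pow q j * pow q i * (qint i * [ i ]⁻¹)        ≈⟨ *-cong qʲqⁱ≈1 ([m][m]⁻¹≈1 1≤i i<n) ⟩
        1# * 1#                                       ≈⟨ *-identityˡ 1# ⟩
        1#                                            ∎
        where
        -x*-y≈x*y : ∀ x y → - x * - y ≈ x * y
        -x*-y≈x*y x y = trans (sym (-‿distribˡ-* x (- y))) (trans (-‿cong (sym (-‿distribʳ-* x y))) (-‿involutive (x * y)))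

    [n∸i]⁻¹≈-Fhatᵢ : [ n ∸ i ]⁻¹ ≈ - Fhat i
    [n∸i]⁻¹≈-Fhatᵢ = ⁻¹-unique [j]-Fhatᵢ≈1

    Fhat[n∸i]≈-[i]⁻¹ : Fhat (n ∸ i) ≈ - [ i ]⁻¹
    Fhat[n∸i]≈-[i]⁻¹ = begin
      pow q j * [ j ]⁻¹                 ≈⟨ *-congˡ [n∸i]⁻¹≈-Fhatᵢ ⟩
      pow q j * - (pow q i * [ i ]⁻¹)   ≈⟨ -‿distribʳ-* _ _ ⟨
      - (pow q j * (pow q i * [ i ]⁻¹)) ≈⟨ -‿cong (trans (sym (*-assoc _ _ _)) (trans (*-congʳ qʲqⁱ≈1) (*-identityˡ _))) ⟩
      - [ i ]⁻¹                         ∎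

    Fk[n∸i] : ∀ k → Fk (suc k) (n ∸ i) ≈ pow (- [ i ]⁻¹) k * - Fhat i
    Fk[n∸i] k = trans (Fk≈Fhat^k[m]⁻¹ k j) (*-cong (pow-cong k Fhat[n∸i]≈-[i]⁻¹) [n∸i]⁻¹≈-Fhatᵢ)

  blockValue : ℕ → Maybe (List ℕ) → Carrier
  blockValue m = maybe′ (coeffBlocks m) 0#

  uWord≡blockValue : ∀ m w → uWord m w ≡ blockValue m (blocks 0 w)
  uWord≡blockValue m w with blocks 0 w
  ... | just ks = ≡.refl
  ... | nothing = ≡.refl

  blocks-a∷ : ∀ k w → blocks k (a ∷ w) ≡ blocks (suc k) w
  blocks-a∷ zero    w = ≡.refl
  blocks-a∷ (suc k) w = ≡.refl

  blocks-b∷ : ∀ k w → blocks k (b ∷ w) ≡ Maybe.map (k ∷_) (blocks 0 w)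
  blocks-b∷ zero    w = ≡.refl
  blocks-b∷ (suc k) w = ≡.refl

  blockValue-b∷ : ∀ k w mb → (λ m → blockValue m mb) ≈[< n ] L w →
    (λ m → blockValue m (Maybe.map (k ∷_) mb)) ≈[< n ] (λ m → pow (φ m) k * L (b ∷ w) m)
  blockValue-b∷ k w nothing   mb≈Lw {m} m<n = sym (begin
    pow (φ m) k * partialSums (L w) m          ≈⟨ *-congˡ (partialSums-cong-< (λ i<n → sym (mb≈Lw i<n)) m<n) ⟩
    pow (φ m) k * partialSums (λ _ → 0#) m     ≈⟨ *-congˡ (partialSums-zero m) ⟩
    pow (φ m) k * 0#                           ≈⟨ zeroʳ _ ⟩
    0#                                         ∎)
  blockValue-b∷ k w (just ks) mb≈Lw {zero}  m<n = sym (zeroʳ _)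
  blockValue-b∷ k w (just ks) mb≈Lw {suc m} m<n = begin
    G k (suc m) * sumFrom 0 (suc m) (λ i → coeffBlocks i ks)   ≈⟨ *-cong (G≈Fhat^k k (s≤s z≤n) m<n) (reflexive (sumFrom≡∑ 0 (suc m) _)) ⟩
    pow (φ (suc m)) k * partialSums (λ i → coeffBlocks i ks) (suc m) ≈⟨ *-congˡ (partialSums-cong-< mb≈Lw m<n) ⟩
    pow (φ (suc m)) k * partialSums (L w) (suc m)               ∎

  blockValue-L : ∀ k w → (λ m → blockValue m (blocks k w)) ≈[< n ] (λ m → pow (φ m) k * L w m)
  blockValue-L zero    []      {zero}  _   = sym (*-identityˡ 1#)
  blockValue-L zero    []      {suc m} _   = sym (zeroʳ 1#)
  blockValue-L (suc k) []      {zero}  _   = sym (trans (*-congʳ (zeroˡ _)) (zeroˡ 1#))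
  blockValue-L (suc k) []      {suc m} _   = sym (zeroʳ _)
  blockValue-L k       (a ∷ w) {m}     m<n = begin
    blockValue m (blocks k (a ∷ w))        ≡⟨ ≡.cong (blockValue m) (blocks-a∷ k w) ⟩
    blockValue m (blocks (suc k) w)        ≈⟨ blockValue-L (suc k) w m<n ⟩
    φ m * pow (φ m) k * L w m              ≈⟨ xy∙z≈y∙xz (φ m) (pow (φ m) k) (L w m) ⟩
    pow (φ m) k * (φ m * L w m)            ∎
  blockValue-L k       (b ∷ w) {m}     m<n = begin
    blockValue m (blocks k (b ∷ w))                  ≡⟨ ≡.cong (blockValue m) (blocks-b∷ k w) ⟩
    blockValue m (Maybe.map (k ∷_) (blocks 0 w))     ≈⟨ blockValue-b∷ k w (blocks 0 w) (λ i<n → trans (blockValue-L 0 w i<n) (*-identityˡ _)) m<n ⟩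
    pow (φ m) k * partialSums (L w) m                ∎

  u≈Lᴴ : ∀ x → (λ m → u m x) ≈[< n ] Lᴴ x
  u≈Lᴴ []             m<n = refl
  u≈Lᴴ ((s , w) ∷ xs) {m} m<n = +-cong (*-congˡ uWord≈L) (u≈Lᴴ xs m<n)
    where
    uWord≈L : uWord m w ≈ L w m
    uWord≈L = trans (reflexive (uWord≡blockValue m w)) (trans (blockValue-L 0 w m<n) (*-identityˡ _))

  φ-twisted : ∀ {m} → m < n → ∀ i j → suc i +ℕ suc j ≡ m →
    φ m * (φ (suc i) + (φ (suc j) + ħ)) ≈ φ (suc i) * φ (suc j)
  φ-twisted m<n i j ≡.refl = Fhat-twisted (s≤s z≤n) (s≤s z≤n) m<n

  L-shw : ∀ {w w'} → Admissible w → Admissible w' → Lᴴ (shw w w') ≈[< n ] L w ∗ L w'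
  L-shw {w' = w'} [] _ {m} _ = begin
    1# * L w' m + 0#         ≈⟨ trans (+-identityʳ _) (*-identityˡ _) ⟩
    L w' m                   ≈⟨ ∗-identityˡ (L w') m ⟨
    (δ ∗ L w') m             ∎
  L-shw {b ∷ w} {w'} (b∷ p) p' {m} m<n = begin
    Lᴴ (prefix b (shw w w')) m       ≈⟨ Lᴴ-prefix-b (shw w w') m ⟩
    partialSums (Lᴴ (shw w w')) m    ≈⟨ partialSums-cong-< (L-shw p p') m<n ⟩
    partialSums (L w ∗ L w') m       ≈⟨ partialSums-∗ˡ (L w) (L w') m ⟨
    (L (b ∷ w) ∗ L w') m             ∎
  L-shw {w} (a∷ p) [] {m} _ = begin
    1# * L w m + 0#          ≈⟨ trans (+-identityʳ _) (*-identityˡ _) ⟩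
    L w m                    ≈⟨ ∗-identityʳ (L w) m ⟨
    (L w ∗ δ) m              ∎
  L-shw {w} {b ∷ w'} q@(a∷ _) (b∷ p') {m} m<n = begin
    Lᴴ (prefix b (shw w w')) m       ≈⟨ Lᴴ-prefix-b (shw w w') m ⟩
    partialSums (Lᴴ (shw w w')) m    ≈⟨ partialSums-cong-< (L-shw q p') m<n ⟩
    partialSums (L w ∗ L w') m       ≈⟨ partialSums-∗ʳ (L w) (L w') m ⟨
    (L w ∗ L (b ∷ w')) m             ∎
  L-shw {a ∷ v@(l ∷ u)} {a ∷ v'@(l' ∷ u')} q@(a∷ p) q'@(a∷ p') {m} m<n = begin
    Lᴴ (prefix a (X₁ ++ X₂ ++ scale ħ X₃)) m     ≈⟨ Lᴴ-prefix-a (X₁ ++ X₂ ++ scale ħ X₃) m ⟩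
    φ m * Lᴴ (X₁ ++ X₂ ++ scale ħ X₃) m           ≈⟨ *-congˡ (trans (extend-++ L X₁ _ m) (+-congˡ (trans (extend-++ L X₂ _ m) (+-congˡ (extend-scale L ħ X₃ m))))) ⟩
    φ m * (Lᴴ X₁ m + (Lᴴ X₂ m + ħ * Lᴴ X₃ m))
      ≈⟨ *-congˡ (+-cong (L-shw q p' m<n) (+-cong (L-shw p q' m<n) (*-congˡ (L-shw p p' m<n)))) ⟩
    φ m * ((L (a ∷ v) ∗ L v') m + ((L v ∗ L (a ∷ v')) m + ħ * (L v ∗ L v') m))
      ≈⟨ ⊙-∗-leibniz φ ħ (L v) (L v') m (φ-twisted m<n) (L-∷-zero l u) (L-∷-zero l' u') ⟩
    (L (a ∷ v) ∗ L (a ∷ v')) m                    ∎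
    where
    X₁ = shw (a ∷ v) v'
    X₂ = shw v (a ∷ v')
    X₃ = shw v v'

  Lᴴ-sh : ∀ {xs ys} → AdmissibleTerms xs → AdmissibleTerms ys → Lᴴ (sh xs ys) ≈[< n ] Lᴴ xs ∗ Lᴴ ys
  Lᴴ-sh {xs} {ys} ps qs {m} m<n = begin
    Lᴴ (sh xs ys) m                   ≈⟨ extend-concatMap (λ w → L w ∗ Lᴴ ys) _ m row ps ⟩
    extend (λ w → L w ∗ Lᴴ ys) xs m   ≈⟨ extend-∗ˡ L (Lᴴ ys) xs m ⟩
    (Lᴴ xs ∗ Lᴴ ys) m                 ∎
    where
    row : ∀ {s w} → Admissible w →
      Lᴴ (concatMap (λ t → scale (s * proj₁ t) (shw w (proj₂ t))) ys) m ≈ s * (L w ∗ Lᴴ ys) m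
    row {s} {w} p = begin
      Lᴴ (concatMap (λ t → scale (s * proj₁ t) (shw w (proj₂ t))) ys) m
        ≈⟨ extend-concatMap (λ w' → s · (L w ∗ L w')) _ m entry qs ⟩
      extend (λ w' → s · (L w ∗ L w')) ys m   ≈⟨ extend-· (λ w' → L w ∗ L w') s ys m ⟩
      s * extend (λ w' → L w ∗ L w') ys m     ≈⟨ *-congˡ (extend-∗ʳ L (L w) ys m) ⟩
      s * (L w ∗ Lᴴ ys) m                     ∎
      where
      entry : ∀ {t w'} → Admissible w' → Lᴴ (scale (s * t) (shw w w')) m ≈ t * (s * (L w ∗ L w') m)
      entry {t} {w'} p' = begin
        Lᴴ (scale (s * t) (shw w w')) m   ≈⟨ extend-scale L (s * t) (shw w w') m ⟩
        s * t * Lᴴ (shw w w') m           ≈⟨ *-congˡ (L-shw p p' m<n) ⟩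
        s * t * (L w ∗ L w') m            ≈⟨ xy∙z≈y∙xz s t ((L w ∗ L w') m) ⟩
        t * (s * (L w ∗ L w') m)          ∎

  Lᴴ-e : ∀ {k} → 1 ≤ k → Lᴴ (e k) ≈[< n ] F k
  Lᴴ-e {suc k} _ {m} m<n = begin
    1# * (φ m * Lₖ) + (ħ * Lₖ + 0#)     ≈⟨ +-cong (*-identityˡ _) (+-identityʳ _) ⟩
    φ m * Lₖ + ħ * Lₖ                   ≈⟨ distribʳ Lₖ (φ m) ħ ⟨
    (φ m + ħ) * Lₖ                      ≈⟨ *-congˡ (L-aᵏ k (b ∷ []) m) ⟩
    (φ m + ħ) * (pow (φ m) k * partialSums δ m)  ≈⟨ value m m<n ⟩
    F (suc k) m                         ∎
    where
    Lₖ = L (as k ++ b ∷ []) m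
    value : ∀ m → m < n → (φ m + ħ) * (pow (φ m) k * partialSums δ m) ≈ F (suc k) m
    value zero    _   = trans (*-congˡ (zeroʳ _)) (zeroʳ _)
    value (suc m) m<n = begin
      (Fhat (suc m) + ħ) * (pow (Fhat (suc m)) k * (1# + ∑[ i < m ] 0#))
        ≈⟨ *-cong (Fhat+ħ≈[m]⁻¹ (s≤s z≤n) m<n) (*-congˡ (trans (+-congˡ (sum-replicate-zero m)) (+-identityʳ 1#))) ⟩
      [ suc m ]⁻¹ * (pow (Fhat (suc m)) k * 1#)   ≈⟨ trans (*-comm _ _) (*-congʳ (*-identityʳ _)) ⟩
      pow (Fhat (suc m)) k * [ suc m ]⁻¹          ≈⟨ Fk≈Fhat^k[m]⁻¹ k (suc m) ⟨
      Fk (suc k) (suc m)                          ∎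

  Lᴴ-shuffleE : ∀ {ks} → All (1 ≤_) ks → Lᴴ (shuffleE ks) ≈[< n ] (λ m → omega m ks)
  Lᴴ-shuffleE {[]}     []         {m} _   = trans (trans (+-identityʳ _) (*-identityˡ (δ m))) (reflexive (≡.sym (omega-[] m)))
  Lᴴ-shuffleE {k ∷ ks} (1≤k ∷ ps) {m} m<n = begin
    Lᴴ (sh (e k) (shuffleE ks)) m              ≈⟨ Lᴴ-sh (e-admissible k) (shuffleE-admissible ks) m<n ⟩
    (Lᴴ (e k) ∗ Lᴴ (shuffleE ks)) m            ≈⟨ ∗-cong-< (Lᴴ-e 1≤k) (Lᴴ-shuffleE ps) m<n ⟩
    (F k ∗ (λ i → omega i ks)) m               ≈⟨ omega-∷ k ks m ⟨
    omega m (k ∷ ks)                           ∎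

module BothSides {c ℓ} (K : Field c ℓ) (ζ : Field.Carrier K) (n : ℕ)
  (ζ-primitive : PrimitiveRoot K (suc n) ζ) where
  open Field K
  open AtRoot K ζ
  open QSeries K ζ
  open FieldProperties K
  open AtPrimitiveRoot K ζ (suc n) ζ-primitive
  open import Algebra.Properties.Semiring.Sum semiring
  open import Algebra.Properties.CommutativeSemigroup *-commutativeSemigroup
    using (x∙yz≈y∙xz; x∙yz≈z∙xy)
  open import Relation.Binary.Reasoning.Setoid setoid

  omega-∷ʳ-at-root : ∀ k ks r →
    omega (suc n) ((k ∷ ks) ∷ʳ suc r)
      ≈ ∑[ i < n ] (omega (suc (toℕ i)) (k ∷ ks) * (pow (- [ suc (toℕ i) ]⁻¹) r * - Fhat (suc (toℕ i))))
  omega-∷ʳ-at-root k ks r = begin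
    omega (suc n) ((k ∷ ks) ∷ʳ suc r)             ≈⟨ omega-∷ʳ (k ∷ ks) (suc r) (suc n) ⟩
    0# * F (suc r) (suc n) + partialSums h (suc n)  ≈⟨ trans (+-congʳ (zeroˡ _)) (+-identityˡ _) ⟩
    partialSums h (suc n)                         ≈⟨ partialSums-suc h n ⟩
    partialSums h n + Ω n * F (suc r) (n ∸ n)      ≈⟨ +-congˡ (*-congˡ (reflexive (≡.cong (F (suc r)) (ℕ.n∸n≡0 n)))) ⟩
    partialSums h n + Ω n * 0#                     ≈⟨ trans (+-congˡ (zeroʳ _)) (+-identityʳ _) ⟩
    partialSums h n                               ≈⟨ sum-cong-≋ {n} (λ i → *-congˡ (reflected (toℕ<n i))) ⟩
    ∑[ i < n ] (omega (suc (toℕ i)) (k ∷ ks) * (pow (- [ suc (toℕ i) ]⁻¹) r * - Fhat (suc (toℕ i)))) ∎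
    where
    Ω : Seq
    Ω i = omega (suc i) (k ∷ ks)
    h : Seq
    h i = Ω i * F (suc r) (n ∸ i)
    reflected : ∀ {i} → i < n → F (suc r) (n ∸ i) ≈ pow (- [ suc i ]⁻¹) r * - Fhat (suc i)
    reflected {i} i<n = trans (reflexive (F-pos (suc r) (ℕ.m<n⇒0<n∸m i<n))) (Reflection.Fk[n∸i] (s≤s z≤n) (s≤s i<n) r)

  z-aPow-shuffleE : ∀ {ks} → All (1 ≤_) ks → ∀ j →
    z (suc n) (aPow j (shuffleE ks)) ≈ ∑[ i < n ] (pow (Fhat (suc (toℕ i))) j * omega (suc (toℕ i)) ks)
  z-aPow-shuffleE {ks} ks≥1 j = begin
    z (suc n) (aPow j (shuffleE ks))                        ≡⟨ sumFrom≡∑ 1 n _ ⟩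
    ∑[ i < n ] u (suc (toℕ i)) (aPow j (shuffleE ks))       ≈⟨ sum-cong-≋ {n} (λ i → value (s≤s (toℕ<n i))) ⟩
    ∑[ i < n ] (pow (Fhat (suc (toℕ i))) j * omega (suc (toℕ i)) ks) ∎
    where
    value : ∀ {m} → suc m < suc n → u (suc m) (aPow j (shuffleE ks)) ≈ pow (Fhat (suc m)) j * omega (suc m) ks
    value {m} m<n = begin
      u (suc m) (aPow j (shuffleE ks))              ≈⟨ u≈Lᴴ (aPow j (shuffleE ks)) m<n ⟩
      Lᴴ (aPow j (shuffleE ks)) (suc m)             ≈⟨ Lᴴ-aPow j (shuffleE ks) (suc m) ⟩
      pow (φ (suc m)) j * Lᴴ (shuffleE ks) (suc m)  ≈⟨ *-congˡ (Lᴴ-shuffleE ks≥1 m<n) ⟩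
      pow (Fhat (suc m)) j * omega (suc m) ks       ∎

  rhs-as-sum : ∀ {ks} → All (1 ≤_) ks → ∀ r →
    rhs (suc n) ks (suc r)
      ≈ ∑[ i < n ] (omega (suc (toℕ i)) ks * (pow (- 1#) (suc r) * (Fhat (suc (toℕ i)) * pow [ suc (toℕ i) ]⁻¹ r)))
  rhs-as-sum {ks} ks≥1 r = begin
    σ * sumRange 1 (suc r) (λ j → natK (r C (j ∸ 1)) * pow ħ (suc r ∸ j) * z (suc n) (aPow j (shuffleE ks)))
      ≡⟨ ≡.cong (σ *_) (sumFrom≡∑ 1 (suc r) _) ⟩
    σ * ∑[ j ≤ r ] (γ j * z (suc n) (aPow (suc (toℕ j)) (shuffleE ks)))
      ≈⟨ *-congˡ (sum-cong-≋ {suc r} λ j → *-congˡ {γ j} (z-aPow-shuffleE ks≥1 (suc (toℕ j)))) ⟩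
    σ * ∑[ j ≤ r ] (γ j * ∑[ i < n ] t j i)
      ≈⟨ *-congˡ (sum-cong-≋ {suc r} λ j → *-distribˡ-sum {n} (γ j) (t j)) ⟩
    σ * ∑[ j ≤ r ] ∑[ i < n ] (γ j * t j i)
      ≈⟨ *-congˡ (∑-comm (λ j i → γ j * t j i)) ⟩
    σ * ∑[ i < n ] ∑[ j ≤ r ] (γ j * t j i)
      ≈⟨ *-congˡ (sum-cong-≋ {n} λ i → column (suc (toℕ i)) (s≤s z≤n) (s≤s (toℕ<n i))) ⟩
    σ * ∑[ i < n ] (Ω (suc (toℕ i)) * T (suc (toℕ i)))
      ≈⟨ *-distribˡ-sum {n} σ (λ i → Ω (suc (toℕ i)) * T (suc (toℕ i))) ⟩
    ∑[ i < n ] (σ * (Ω (suc (toℕ i)) * T (suc (toℕ i))))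
      ≈⟨ sum-cong-≋ {n} (λ i → x∙yz≈y∙xz σ (Ω (suc (toℕ i))) (T (suc (toℕ i)))) ⟩
    ∑[ i < n ] (Ω (suc (toℕ i)) * (σ * T (suc (toℕ i)))) ∎
    where
    σ = pow (- 1#) (suc r)
    Ω : Seq
    Ω m = omega m ks
    T : Seq
    T m = Fhat m * pow [ m ]⁻¹ r
    γ : Fin (suc r) → Carrier
    γ j = natK (r C toℕ j) * pow ħ (r ∸ toℕ j)
    t : Fin (suc r) → Fin n → Carrier
    t j i = pow (Fhat (suc (toℕ i))) (suc (toℕ j)) * Ω (suc (toℕ i))

    column : ∀ m → 1 ≤ m → m < suc n →
      ∑[ j ≤ r ] (γ j * (pow (Fhat m) (suc (toℕ j)) * Ω m)) ≈ Ω m * T m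
    column m 1≤m m<n = begin
      ∑[ j ≤ r ] (γ j * (pow (Fhat m) (suc (toℕ j)) * Ω m))
        ≈⟨ sum-cong-≋ {suc r} (λ j → x∙yz≈z∙xy (γ j) (pow (Fhat m) (suc (toℕ j))) (Ω m)) ⟩
      ∑[ j ≤ r ] (Ω m * (γ j * pow (Fhat m) (suc (toℕ j))))
        ≈⟨ *-distribˡ-sum {suc r} (Ω m) (λ j → γ j * pow (Fhat m) (suc (toℕ j))) ⟨
      Ω m * ∑[ j ≤ r ] (γ j * pow (Fhat m) (suc (toℕ j)))
        ≈⟨ *-congˡ (binomial-shifted (Fhat m) ħ r) ⟩
      Ω m * (Fhat m * pow (Fhat m + ħ) r)
        ≈⟨ *-congˡ (*-congˡ (pow-cong r (Fhat+ħ≈[m]⁻¹ 1≤m m<n))) ⟩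
      Ω m * T m ∎

theorem4p4 : ∀ {c ℓ : Level} (K : Field c ℓ) → CharZero K →
    (n : ℕ) → 1 ≤ n → (ζ : Field.Carrier K) → PrimitiveRoot K n ζ →
    (ks : List ℕ) (kr : ℕ) → 1 ≤ length ks → All (1 ≤_) ks → 1 ≤ kr →
    Field._≈_ K (AtRoot.omega K ζ n (ks ∷ʳ kr)) (AtRoot.rhs K ζ n ks kr)
theorem4p4 K _ zero    () _ _           _        _       _  _    _
theorem4p4 K _ (suc n) _  _ _           []       _       () _    _
theorem4p4 K _ (suc n) _  _ _           (_ ∷ _)  zero    _  _    ()
theorem4p4 K _ (suc n) _  ζ ζ-primitive (k ∷ ks) (suc r) _  ks≥1 _ = begin
  omega (suc n) ((k ∷ ks) ∷ʳ suc r)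
    ≈⟨ omega-∷ʳ-at-root k ks r ⟩
  ∑[ i < n ] (omega (m i) (k ∷ ks) * (pow (- [ m i ]⁻¹) r * - Fhat (m i)))
    ≈⟨ sum-cong-≋ {n} (λ i → *-congˡ (pow-neg-*-neg [ m i ]⁻¹ (Fhat (m i)) r)) ⟩
  ∑[ i < n ] (omega (m i) (k ∷ ks) * (pow (- 1#) (suc r) * (Fhat (m i) * pow [ m i ]⁻¹ r)))
    ≈⟨ rhs-as-sum ks≥1 r ⟨
  rhs (suc n) (k ∷ ks) (suc r) ∎
  where
  open Field K
  open AtRoot K ζ
  open QSeries K ζ using ([_]⁻¹)
  open FieldProperties K using (pow-neg-*-neg)
  open BothSides K ζ n ζ-primitive
  open import Algebra.Properties.Semiring.Sum semiring using (sum-syntax; sum-cong-≋)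
  open import Relation.Binary.Reasoning.Setoid setoid

  m : Fin n → ℕ
  m i = suc (toℕ i)
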